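{- Let $\langle A,B,R\rangle$ be a finite bipartite graph with $R\subseteq A\times B$. Let $\{A_i:i\in I\}$ be a partition of $A$ and $\{B_j:j\in J\}$ a partition of $B$ such that for all $i\in I$, $j\in J$: (1) for all $a,a'\in A_i$, $|\{b\in B_j:(a,b)\in R\}|=|\{b\in B_j:(a',b)\in R\}|$; and (2) for all $b,b'\in B_j$, $|\{a\in A_i:(a,b)\in R\}|=|\{a\in A_i:(a,b')\in R\}|$. Let $R^+=\bigcup\{A_i\times B_j: (A_i\times B_j)\cap R\neq\emptyset\}$. If $\langle A,B,R^+\rangle$ has a complete matching, then so does $\langle A,B,R\rangle$.
   Context: A matching in a bipartite graph $\langle A,B,R\rangle$ is a partial one-to-one function $M$ from $A$ into $B$ with $M\subseteq R$; it is complete if its domain is all of $A$. (In the paper the partitions are those produced by an iterated refinement procedure which additionally equips $I$ and $J$ with linear orderings; these orderings play no role in the statement.) -}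

module Defs where

open import Data.Nat using (ℕ)
open import Data.Fin using (Fin)
open import Data.Bool using (Bool; true; false; _∧_)
open import Data.Fin.Properties using (_≟_)
open import Relation.Nullary.Decidable using (⌊_⌋)
open import Data.List using (List; length; filter)
open import Data.List using () renaming (allFin to allFinL)
open import Data.Product using (Σ; _×_; ∃)
open import Relation.Binary.PropositionalEquality using (_≡_)
open import Function.Definitions using (Injective)

BipRel : ℕ → ℕ → Set
BipRel m n = Fin m → Fin n → Bool

count : {n : ℕ} → (Fin n → Bool) → ℕ
count {n} P = length (filter (λ x → Data.Bool._≟_ (P x) true) (allFinL n))

-- A partition {A_i : i ∈ I} of Fin m with I = Fin k is given by the
-- block-assignment map p : Fin m → Fin k, with A_i = p⁻¹(i).
-- indicator of membership in the block j
inBlock : {n l : ℕ} → (Fin n → Fin l) → Fin l → Fin n → Bool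
inBlock q j x = ⌊ q x ≟ j ⌋

degInto : {m n l : ℕ} → BipRel m n → (Fin n → Fin l) → Fin m → Fin l → ℕ
degInto R q a j = count (λ b → inBlock q j b ∧ R a b)

degFrom : {m n k : ℕ} → BipRel m n → (Fin m → Fin k) → Fin n → Fin k → ℕ
degFrom R p b i = count (λ a → inBlock p i a ∧ R a b)

RPlus : {m n k l : ℕ} → BipRel m n → (Fin m → Fin k) → (Fin n → Fin l) →
        Fin m → Fin n → Set
RPlus R p q a b = Σ _ λ a' → Σ _ λ b' → p a' ≡ p a × q b' ≡ q b × R a' b' ≡ true

-- A complete matching in ⟨A,B,S⟩: a one-to-one function M : A → B with M ⊆ S
-- (total domain = complete).
CompleteMatching : {m n : ℕ} → (Fin m → Fin n → Set) → Set
CompleteMatching {m} {n} S =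
  Σ (Fin m → Fin n) λ M → Injective _≡_ _≡_ M × (∀ a → S a (M a))

{-# OPTIONS --safe #-}
module Submission where

-- By Hall's theorem it suffices that |X| ≤ |N(X)| for every X ⊆ A.  Where a block A_i meets
-- a block B_j in R, the equitability conditions make R between them biregular, and double
-- counting its edges gives |X ∩ A_i| / |A_i| ≤ |N(X) ∩ B_j| / |B_j|.  Now |X| is the sum over
-- a ∈ A of the density of X in the block of a; the complete R⁺-matching M sends a into a block
-- linked to the block of a, so |X| ≤ ∑_a (density of N(X) at M a) ≤ |N(X)| as M is injective.
-- The densities are made integral by scaling with (m + n)!.  Hall's theorem itself is proved
-- by the Halmos–Vaughan induction: split S along a critical subset if there is one, otherwise
-- match one vertex and delete its partner.

open import Defs
open import Algebra.Bundles using (CommutativeMonoid)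
open import Data.Bool using (Bool; true; false; _∧_; _∨_; not; if_then_else_)
import Data.Bool as Bool
open import Data.Bool.Properties using (∨-zeroʳ; ∧-commutativeMonoid)
open import Algebra.Properties.CommutativeSemigroup
  (CommutativeMonoid.commutativeSemigroup ∧-commutativeMonoid)
  using () renaming (x∙yz≈y∙xz to ∧-swap)
open import Data.Empty using (⊥-elim)
open import Data.Fin using (Fin; zero; suc)
open import Data.Fin.Properties using (_≟_; any?; all?)
open import Data.Fin.Subset using (Subset)
open import Data.Fin.Subset.Properties using (anySubset?)
open import Data.List using ([]; _∷_; length; filter; tabulate)
open import Data.Nat
  using (ℕ; zero; suc; _+_; _*_; _≤_; _<_; _!; z≤n; s≤s; NonZero; >-nonZero; _≤?_; _<?_)
open import Data.Nat.Divisibility using (_∣_; quotient; ∣-trans; m∣m*n; m≤n⇒m!∣n!)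
open import Data.Nat.Properties hiding (_≟_)
open import Data.Nat.Tactic.RingSolver using (solve)
open import Data.Product using (∃; _×_; _,_; proj₁; proj₂)
open import Data.Sum using (_⊎_; inj₁; inj₂)
open import Data.Vec using (lookup) renaming (tabulate to tabulateᵛ)
open import Data.Vec.Properties using (lookup∘tabulate)
open import Function using (_∘_; id; flip; case_of_)
open import Function.Definitions using (Injective)
open import Relation.Binary.PropositionalEquality
open import Relation.Nullary using (¬_; Dec; yes; no; map′; _×-dec_; _→-dec_)
open import Relation.Nullary.Decidable using (⌊_⌋; ⌊⌋-map′)
open import Algebra.Properties.Semiring.Sum +-*-semiring
  using (sum; sum-syntax; sum-cong-≗; ∑-comm; ∑-distrib-+; *-distribˡ-sum; *-distribʳ-sum;
         sum-replicate-zero)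

variable
  m n k l : ℕ

𝟙 : Bool → ℕ
𝟙 true  = 1
𝟙 false = 0

𝟙≤1 : ∀ x → 𝟙 x ≤ 1
𝟙≤1 true  = ≤-refl
𝟙≤1 false = z≤n

𝟙-∧ : ∀ x y → 𝟙 (x ∧ y) ≡ 𝟙 x * 𝟙 y
𝟙-∧ true  y = sym (+-identityʳ (𝟙 y))
𝟙-∧ false y = refl

𝟙-mono : ∀ {x y} → (x ≡ true → y ≡ true) → 𝟙 x ≤ 𝟙 y
𝟙-mono {false}         _   = z≤n
𝟙-mono {true}  {true}  _   = ≤-refl
𝟙-mono {true}  {false} x⇒y = case x⇒y refl of λ ()

𝟙-absurd : ∀ {x} → x ≢ true → 𝟙 x ≡ 0
𝟙-absurd {false} _   = refl
𝟙-absurd {true}  x≢t = ⊥-elim (x≢t refl)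

𝟙-∨ : ∀ x y → 𝟙 (x ∨ y) ≤ 𝟙 x + 𝟙 y
𝟙-∨ true  y = s≤s z≤n
𝟙-∨ false y = ≤-refl

𝟙-∨-disjoint : ∀ {x y} → (x ≡ true → y ≢ true) → 𝟙 (x ∨ y) ≡ 𝟙 x + 𝟙 y
𝟙-∨-disjoint {false}        _    = refl
𝟙-∨-disjoint {true} {false} _    = refl
𝟙-∨-disjoint {true} {true}  x⇒¬y = ⊥-elim (x⇒¬y refl refl)

𝟙-∖ : ∀ {x y} → (y ≡ true → x ≡ true) → 𝟙 x ≡ 𝟙 (x ∧ not y) + 𝟙 y
𝟙-∖ {true}  {true}  _   = refl
𝟙-∖ {true}  {false} _   = refl
𝟙-∖ {false} {false} _   = refl
𝟙-∖ {false} {true}  y⇒x = case y⇒x refl of λ ()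

∧-elim : ∀ {x y} → x ∧ y ≡ true → x ≡ true × y ≡ true
∧-elim {true} y≡t = refl , y≡t

∨-elim : ∀ {x y} → x ∨ y ≡ true → x ≡ true ⊎ y ≡ true
∨-elim {true}  _   = inj₁ refl
∨-elim {false} y≡t = inj₂ y≡t

∨-introʳ : ∀ x {y} → y ≡ true → x ∨ y ≡ true
∨-introʳ x refl = ∨-zeroʳ x

not-intro : ∀ {x} → x ≢ true → not x ≡ true
not-intro {false} _   = refl
not-intro {true}  x≢t = ⊥-elim (x≢t refl)

not-elim : ∀ {x} → not x ≡ true → x ≢ true
not-elim {false} _ ()

toWitness≡ : ∀ {A : Set} {a? : Dec A} → ⌊ a? ⌋ ≡ true → A
toWitness≡ {a? = yes a} _ = a

fromWitness≡ : ∀ {A : Set} {a? : Dec A} → A → ⌊ a? ⌋ ≡ true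
fromWitness≡ {a? = yes _}  _ = refl
fromWitness≡ {a? = no ¬a} a = ⊥-elim (¬a a)

∑-mono-≤ : ∀ {f g : Fin n → ℕ} → (∀ x → f x ≤ g x) → ∑[ x < n ] f x ≤ ∑[ x < n ] g x
∑-mono-≤ {zero}  _   = z≤n
∑-mono-≤ {suc n} f≤g = +-mono-≤ (f≤g zero) (∑-mono-≤ (f≤g ∘ suc))

∑-δ : ∀ (a : Fin n) (g : Fin n → ℕ) → ∑[ x < n ] (𝟙 ⌊ a ≟ x ⌋ * g x) ≡ g a
∑-δ {suc n} zero    g = begin
  1 * g zero + ∑[ x < n ] 0  ≡⟨ cong₂ _+_ (*-identityˡ (g zero)) (sum-replicate-zero n) ⟩
  g zero + 0                 ≡⟨ +-identityʳ (g zero) ⟩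
  g zero                     ∎
  where open ≡-Reasoning
∑-δ {suc n} (suc a) g =
  trans (sum-cong-≗ λ x → cong (λ b → 𝟙 b * g (suc x)) (⌊⌋-map′ _ _ (a ≟ x))) (∑-δ a (g ∘ suc))

infixr 7 _∩_
infixr 6 _∪_ _∖_
infix  4 _⊆_ _⊆?_

_⊆_ : (P Q : Fin n → Bool) → Set
P ⊆ Q = ∀ {x} → P x ≡ true → Q x ≡ true

_∩_ _∪_ _∖_ : (P Q : Fin n → Bool) → Fin n → Bool
(P ∩ Q) x = P x ∧ Q x
(P ∪ Q) x = P x ∨ Q x
(P ∖ Q) x = P x ∧ not (Q x)

⁅_⁆ : Fin n → Fin n → Bool
⁅ a ⁆ x = ⌊ a ≟ x ⌋

-- ∣_∣, neighbours, deg and edges are opaque so that unification can recover their arguments.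
opaque
  ∣_∣ : (Fin n → Bool) → ℕ
  ∣_∣ {n} P = ∑[ x < n ] 𝟙 (P x)

  ∑𝟙*-const : ∀ {P : Fin n → Bool} {f : Fin n → ℕ} {c} → (∀ {x} → P x ≡ true → f x ≡ c) →
              ∑[ x < n ] (𝟙 (P x) * f x) ≡ ∣ P ∣ * c
  ∑𝟙*-const {P = P} {f} {c} f≡c = trans (sum-cong-≗ on-P) (sym (*-distribʳ-sum c (𝟙 ∘ P)))
    where
    on-P : ∀ x → 𝟙 (P x) * f x ≡ 𝟙 (P x) * c
    on-P x with P x in x∈P
    ... | true  = cong (1 *_) (f≡c x∈P)
    ... | false = refl

  ∑∣∣-comm : ∀ (F : Fin m → Fin n → Bool) →
             ∑[ a < m ] ∣ (λ b → F a b) ∣ ≡ ∑[ b < n ] ∣ (λ a → F a b) ∣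
  ∑∣∣-comm F = ∑-comm (λ a b → 𝟙 (F a b))

  ∣∣-cong : ∀ {P Q : Fin n → Bool} → (∀ x → P x ≡ Q x) → ∣ P ∣ ≡ ∣ Q ∣
  ∣∣-cong P≗Q = sum-cong-≗ (cong 𝟙 ∘ P≗Q)

  ∣∣-mono : ∀ {P Q : Fin n → Bool} → P ⊆ Q → ∣ P ∣ ≤ ∣ Q ∣
  ∣∣-mono P⊆Q = ∑-mono-≤ λ x → 𝟙-mono (P⊆Q {x})

  ∣∣≤n : ∀ (P : Fin n → Bool) → ∣ P ∣ ≤ n
  ∣∣≤n {zero}  P = z≤n
  ∣∣≤n {suc n} P = +-mono-≤ (𝟙≤1 (P zero)) (∣∣≤n (P ∘ suc))

  ∣∪∣≤∣∣+∣∣ : ∀ (P Q : Fin n → Bool) → ∣ P ∪ Q ∣ ≤ ∣ P ∣ + ∣ Q ∣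
  ∣∪∣≤∣∣+∣∣ P Q =
    ≤-trans (∑-mono-≤ λ x → 𝟙-∨ (P x) (Q x)) (≤-reflexive (∑-distrib-+ (𝟙 ∘ P) (𝟙 ∘ Q)))

  ∣∪∣-disjoint : ∀ {P Q : Fin n → Bool} → (∀ {x} → P x ≡ true → Q x ≢ true) →
                 ∣ P ∪ Q ∣ ≡ ∣ P ∣ + ∣ Q ∣
  ∣∪∣-disjoint {P = P} {Q} disjoint =
    trans (sum-cong-≗ λ x → 𝟙-∨-disjoint (disjoint {x})) (∑-distrib-+ (𝟙 ∘ P) (𝟙 ∘ Q))

  ∣∣≡∣∖∣+∣∣ : ∀ {P Q : Fin n → Bool} → Q ⊆ P → ∣ P ∣ ≡ ∣ P ∖ Q ∣ + ∣ Q ∣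
  ∣∣≡∣∖∣+∣∣ {P = P} {Q} Q⊆P =
    trans (sum-cong-≗ λ x → 𝟙-∖ (Q⊆P {x})) (∑-distrib-+ (𝟙 ∘ (P ∖ Q)) (𝟙 ∘ Q))

  ∣⁅a⁆∣≡1 : ∀ (a : Fin n) → ∣ ⁅ a ⁆ ∣ ≡ 1
  ∣⁅a⁆∣≡1 a = trans (sum-cong-≗ λ x → sym (*-identityʳ (𝟙 ⌊ a ≟ x ⌋))) (∑-δ a λ _ → 1)

  ∣∣≡0 : ∀ {P : Fin n → Bool} → (∀ x → P x ≢ true) → ∣ P ∣ ≡ 0
  ∣∣≡0 {n} P≡∅ = trans (sum-cong-≗ λ x → 𝟙-absurd (P≡∅ x)) (sum-replicate-zero n)

  count≡∣∣ : ∀ (P : Fin n → Bool) → count P ≡ ∣ P ∣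
  count≡∣∣ P = length-filter-tabulate id
    where
    length-filter-tabulate : (f : Fin k → _) →
      length (filter (λ x → P x Bool.≟ true) (tabulate f)) ≡ ∑[ i < k ] 𝟙 (P (f i))
    length-filter-tabulate {zero}  f = refl
    length-filter-tabulate {suc k} f with P (f zero)
    ... | true  = cong suc (length-filter-tabulate (f ∘ suc))
    ... | false = length-filter-tabulate (f ∘ suc)

∑𝟙*≡∣∣* : ∀ (P : Fin n → Bool) c → ∑[ x < n ] (𝟙 (P x) * c) ≡ ∣ P ∣ * c
∑𝟙*≡∣∣* P c = ∑𝟙*-const {P = P} λ _ → refl

∣∩∣≡𝟙*∣∣ : ∀ x (P : Fin n → Bool) → ∣ (λ b → x ∧ P b) ∣ ≡ 𝟙 x * ∣ P ∣
∣∩∣≡𝟙*∣∣ true  P = sym (*-identityˡ ∣ P ∣)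
∣∩∣≡𝟙*∣∣ false P = ∣∣≡0 λ _ ()

∈⇒∣∣>0 : ∀ {P : Fin n → Bool} {a} → P a ≡ true → 0 < ∣ P ∣
∈⇒∣∣>0 {P = P} {a} a∈P = begin
  1          ≡⟨ ∣⁅a⁆∣≡1 a ⟨
  ∣ ⁅ a ⁆ ∣  ≤⟨ ∣∣-mono (λ a≡x → subst (λ x → P x ≡ true) (toWitness≡ a≡x) a∈P) ⟩
  ∣ P ∣      ∎
  where open ≤-Reasoning

∣∣>0⇒∃ : ∀ {P : Fin n → Bool} → 0 < ∣ P ∣ → ∃ λ x → P x ≡ true
∣∣>0⇒∃ {P = P} ∣P∣>0 with any? (λ x → P x Bool.≟ true)
... | yes ∃x∈P = ∃x∈P
... | no  ∄x∈P = ⊥-elim (<⇒≢ ∣P∣>0 (sym (∣∣≡0 λ x x∈P → ∄x∈P (x , x∈P))))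

∣∣≤1 : ∀ {P : Fin n → Bool} → (∀ {x y} → P x ≡ true → P y ≡ true → x ≡ y) → ∣ P ∣ ≤ 1
∣∣≤1 {P = P} unique with any? (λ x → P x Bool.≟ true)
... | yes (a , a∈P) =
  ≤-trans (∣∣-mono λ x∈P → fromWitness≡ (unique a∈P x∈P)) (≤-reflexive (∣⁅a⁆∣≡1 a))
... | no  ∄x∈P = ≤-trans (≤-reflexive (∣∣≡0 λ x x∈P → ∄x∈P (x , x∈P))) z≤n

∣∖∣<∣∣ : ∀ {S X : Fin n → Bool} → X ⊆ S → 0 < ∣ X ∣ → ∣ S ∖ X ∣ < ∣ S ∣
∣∖∣<∣∣ X⊆S ∣X∣>0 = <-≤-trans (m<m+n _ ∣X∣>0) (≤-reflexive (sym (∣∣≡∣∖∣+∣∣ X⊆S)))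

∑-injective-≤ : ∀ {M : Fin m → Fin n} → Injective _≡_ _≡_ M → ∀ (g : Fin n → ℕ) →
                ∑[ a < m ] g (M a) ≤ ∑[ b < n ] g b
∑-injective-≤ {m} {n} {M} M-injective g = begin
  ∑[ a < m ] g (M a)                            ≡⟨ sum-cong-≗ (λ a → ∑-δ (M a) g) ⟨
  ∑[ a < m ] ∑[ b < n ] (𝟙 ⌊ M a ≟ b ⌋ * g b)  ≡⟨ ∑-comm (λ a b → 𝟙 ⌊ M a ≟ b ⌋ * g b) ⟩
  ∑[ b < n ] ∑[ a < m ] (𝟙 ⌊ M a ≟ b ⌋ * g b)  ≡⟨ sum-cong-≗ (λ b → ∑𝟙*≡∣∣* (fibre b) (g b)) ⟩
  ∑[ b < n ] (∣ fibre b ∣ * g b)                ≤⟨ ∑-mono-≤ (λ b → *-monoˡ-≤ (g b) (∣∣≤1 unique)) ⟩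
  ∑[ b < n ] (1 * g b)                          ≡⟨ sum-cong-≗ (λ b → *-identityˡ (g b)) ⟩
  ∑[ b < n ] g b                                ∎
  where
  open ≤-Reasoning
  fibre : Fin n → Fin m → Bool
  fibre b a = ⌊ M a ≟ b ⌋
  unique : ∀ {b x y} → fibre b x ≡ true → fibre b y ≡ true → x ≡ y
  unique Mx≡b My≡b = M-injective (trans (toWitness≡ Mx≡b) (sym (toWitness≡ My≡b)))

opaque
  neighbours : BipRel m n → (Fin m → Bool) → Fin n → Bool
  neighbours R X b = ⌊ any? (λ a → X a ∧ R a b Bool.≟ true) ⌋

  neighbours-intro : ∀ {R : BipRel m n} {X a b} → X a ≡ true → R a b ≡ true →
                     neighbours R X b ≡ true
  neighbours-intro {a = a} a∈X ab∈R = fromWitness≡ (a , cong₂ _∧_ a∈X ab∈R)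

  neighbours-elim : ∀ {R : BipRel m n} {X b} → neighbours R X b ≡ true →
                    ∃ λ a → X a ≡ true × R a b ≡ true
  neighbours-elim b∈NX = let (a , ab) = toWitness≡ b∈NX in a , ∧-elim ab

neighbours-mono : ∀ {R : BipRel m n} {X Y} → X ⊆ Y → neighbours R X ⊆ neighbours R Y
neighbours-mono X⊆Y b∈NX = let (a , a∈X , ab∈R) = neighbours-elim b∈NX in
                           neighbours-intro (X⊆Y a∈X) ab∈R

infixl 5 _without_

_without_ : BipRel m n → (Fin n → Bool) → BipRel m n
(R without B) a b = R a b ∧ not (B b)

module _ {R : BipRel m n} {B : Fin n → Bool} where

  neighbours⊆without∪ : ∀ {Z} → neighbours R Z ⊆ neighbours (R without B) Z ∪ B
  neighbours⊆without∪ {x = b} b∈NZ with B b Bool.≟ true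
  ... | yes b∈B = ∨-introʳ _ b∈B
  ... | no  b∉B = let (a , a∈Z , ab∈R) = neighbours-elim b∈NZ in
                  cong (_∨ B b) (neighbours-intro a∈Z (cong₂ _∧_ ab∈R (not-intro b∉B)))

  neighbours-∪⊆without∪ : ∀ {Z X} → neighbours R X ⊆ B →
                          neighbours R (Z ∪ X) ⊆ neighbours (R without B) Z ∪ B
  neighbours-∪⊆without∪ NX⊆B {b} b∈N[Z∪X] with B b Bool.≟ true
  ... | yes b∈B = ∨-introʳ _ b∈B
  ... | no  b∉B with neighbours-elim b∈N[Z∪X]
  ...   | a , a∈Z∪X , ab∈R with ∨-elim a∈Z∪X
  ...     | inj₁ a∈Z = cong (_∨ B b) (neighbours-intro a∈Z (cong₂ _∧_ ab∈R (not-intro b∉B)))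
  ...     | inj₂ a∈X = ⊥-elim (b∉B (NX⊆B (neighbours-intro a∈X ab∈R)))

record Matching (R : BipRel m n) (S : Fin m → Bool) : Set where
  field
    match           : Fin m → Fin n
    match-edge      : ∀ {a} → S a ≡ true → R a (match a) ≡ true
    match-injective : ∀ {a a′} → S a ≡ true → S a′ ≡ true → match a ≡ match a′ → a ≡ a′

module _ {R : BipRel m n} where

  emptyMatching : ∀ {S} → (Fin m → Fin n) → (∀ a → S a ≢ true) → Matching R S
  emptyMatching M S≡∅ = record
    { match           = M
    ; match-edge      = λ {a} a∈S → ⊥-elim (S≡∅ a a∈S)
    ; match-injective = λ {a} a∈S _ _ → ⊥-elim (S≡∅ a a∈S)
    }

  singletonMatching : ∀ {a b} → R a b ≡ true → Matching R ⁅ a ⁆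
  singletonMatching {b = b} ab∈R = record
    { match           = λ _ → b
    ; match-edge      = λ a≡x → subst (λ x → R x b ≡ true) (toWitness≡ a≡x) ab∈R
    ; match-injective = λ a≡x a≡x′ _ → trans (sym (toWitness≡ a≡x)) (toWitness≡ a≡x′)
    }

  glueMatchings : ∀ {S X B} → X ⊆ S → (M : Matching R X) →
                  (∀ {a} → X a ≡ true → B (Matching.match M a) ≡ true) →
                  Matching (R without B) (S ∖ X) → Matching R S
  glueMatchings {S} {X} {B} X⊆S M M⊆B M′ = record
    { match           = match
    ; match-edge      = edge
    ; match-injective = injective
    }
    where
    module M  = Matching M
    module M′ = Matching M′

    match : Fin m → Fin n
    match a = if X a then M.match a else M′.match a

    M′-edge : ∀ {a} → S a ≡ true → X a ≡ false →
              R a (M′.match a) ≡ true × B (M′.match a) ≢ true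
    M′-edge a∈S a∉X =
      let (ab∈R , b∉B) = ∧-elim (M′.match-edge (cong₂ _∧_ a∈S (cong not a∉X))) in
      ab∈R , not-elim b∉B

    edge : ∀ {a} → S a ≡ true → R a (match a) ≡ true
    edge {a} a∈S with X a in a∈X
    ... | true  = M.match-edge a∈X
    ... | false = proj₁ (M′-edge a∈S a∈X)

    separated : ∀ {a a′} → X a ≡ true → S a′ ≡ true → X a′ ≡ false → M.match a ≢ M′.match a′
    separated a∈X a′∈S a′∉X eq =
      proj₂ (M′-edge a′∈S a′∉X) (subst (λ b → B b ≡ true) eq (M⊆B a∈X))

    injective : ∀ {a a′} → S a ≡ true → S a′ ≡ true → match a ≡ match a′ → a ≡ a′
    injective {a} {a′} a∈S a′∈S eq with X a in a∈X | X a′ in a′∈X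
    ... | true  | true  = M.match-injective a∈X a′∈X eq
    ... | false | false = M′.match-injective (cong₂ _∧_ a∈S (cong not a∈X))
                                             (cong₂ _∧_ a′∈S (cong not a′∈X)) eq
    ... | true  | false = ⊥-elim (separated a∈X a′∈S a′∈X eq)
    ... | false | true  = ⊥-elim (separated a′∈X a∈S a∈X (sym eq))

-- Hall's theorem

HallCondition : BipRel m n → (Fin m → Bool) → Set
HallCondition R S = ∀ X → X ⊆ S → ∣ X ∣ ≤ ∣ neighbours R X ∣

Critical : BipRel m n → (Fin m → Bool) → (Fin m → Bool) → Set
Critical R S X = X ⊆ S × 0 < ∣ X ∣ × ∣ X ∣ < ∣ S ∣ × ∣ neighbours R X ∣ ≤ ∣ X ∣

_⊆?_ : (P Q : Fin n → Bool) → Dec (P ⊆ Q)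
P ⊆? Q = map′ (λ P⊆Q {x} → P⊆Q x) (λ P⊆Q x → P⊆Q)
              (all? λ x → (P x Bool.≟ true) →-dec (Q x Bool.≟ true))

critical? : (R : BipRel m n) (S : Fin m → Bool) →
            Dec (∃ λ (v : Subset m) → Critical R S (lookup v))
critical? R S = anySubset? λ v →
  lookup v ⊆? S ×-dec 0 <? ∣ lookup v ∣ ×-dec ∣ lookup v ∣ <? ∣ S ∣ ×-dec
  ∣ neighbours R (lookup v) ∣ ≤? ∣ lookup v ∣

Critical-cong : ∀ {R : BipRel m n} {S X Y} → (∀ a → X a ≡ Y a) → Critical R S X → Critical R S Y
Critical-cong {S = S} {X} {Y} X≗Y (X⊆S , ∣X∣>0 , X⊂S , tight) =
  (λ a∈Y → X⊆S (Y⊆X a∈Y)) , subst (0 <_) ∣X∣≡∣Y∣ ∣X∣>0 , subst (_< ∣ S ∣) ∣X∣≡∣Y∣ X⊂S ,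
  ≤-trans (∣∣-mono (neighbours-mono Y⊆X)) (≤-trans tight (≤-reflexive ∣X∣≡∣Y∣))
  where
  Y⊆X : Y ⊆ X
  Y⊆X {a} a∈Y = trans (X≗Y a) a∈Y
  ∣X∣≡∣Y∣ : ∣ X ∣ ≡ ∣ Y ∣
  ∣X∣≡∣Y∣ = ∣∣-cong X≗Y

-- The function only supplies the values of a matching outside the set being matched.
module _ {m n : ℕ} (default : Fin m → Fin n) where

  MatchableUpTo : ℕ → Set
  MatchableUpTo k = ∀ {R : BipRel m n} {S} → ∣ S ∣ ≤ k → HallCondition R S → Matching R S

  module _ {k} (matchable : MatchableUpTo k) {R : BipRel m n} {S} (∣S∣≤1+k : ∣ S ∣ ≤ suc k)
           (hallS : HallCondition R S) where

    viaCritical : ∀ {X} → Critical R S X → Matching R S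
    viaCritical {X} (X⊆S , ∣X∣>0 , X⊂S , tight) =
      glueMatchings X⊆S M (λ a∈X → neighbours-intro a∈X (M.match-edge a∈X))
        (matchable (≤-pred (≤-trans (∣∖∣<∣∣ X⊆S ∣X∣>0) ∣S∣≤1+k)) hallRest)
      where
      M : Matching R X
      M = matchable (≤-pred (≤-trans X⊂S ∣S∣≤1+k)) λ Z Z⊆X → hallS Z (X⊆S ∘ Z⊆X)
      module M = Matching M

      R′ = R without neighbours R X

      hallRest : HallCondition R′ (S ∖ X)
      hallRest Z Z⊆S∖X = +-cancelʳ-≤ _ _ _ (begin
        ∣ Z ∣ + ∣ X ∣                             ≡⟨ ∣∪∣-disjoint (not-elim ∘ proj₂ ∘ ∧-elim ∘ Z⊆S∖X) ⟨
        ∣ Z ∪ X ∣                                 ≤⟨ hallS (Z ∪ X) Z∪X⊆S ⟩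
        ∣ neighbours R (Z ∪ X) ∣                  ≤⟨ ∣∣-mono (neighbours-∪⊆without∪ id) ⟩
        ∣ neighbours R′ Z ∪ neighbours R X ∣      ≤⟨ ∣∪∣≤∣∣+∣∣ _ _ ⟩
        ∣ neighbours R′ Z ∣ + ∣ neighbours R X ∣  ≤⟨ +-monoʳ-≤ _ tight ⟩
        ∣ neighbours R′ Z ∣ + ∣ X ∣               ∎)
        where
        open ≤-Reasoning
        Z∪X⊆S : Z ∪ X ⊆ S
        Z∪X⊆S a∈Z∪X with ∨-elim a∈Z∪X
        ... | inj₁ a∈Z = proj₁ (∧-elim (Z⊆S∖X a∈Z))
        ... | inj₂ a∈X = X⊆S a∈X

    viaVertex : ∀ {a₀} → S a₀ ≡ true → (∀ X → ¬ Critical R S X) → Matching R S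
    viaVertex {a₀} a₀∈S noCritical =
      glueMatchings ⁅a₀⁆⊆S (singletonMatching a₀b₁∈R) (λ _ → fromWitness≡ refl)
        (matchable (≤-pred (≤-trans S∖a₀⊂S ∣S∣≤1+k)) hallRest)
      where
      ⁅a₀⁆⊆S : ⁅ a₀ ⁆ ⊆ S
      ⁅a₀⁆⊆S a₀≡x = subst (λ x → S x ≡ true) (toWitness≡ a₀≡x) a₀∈S

      S∖a₀⊂S : ∣ S ∖ ⁅ a₀ ⁆ ∣ < ∣ S ∣
      S∖a₀⊂S = ∣∖∣<∣∣ ⁅a₀⁆⊆S (∈⇒∣∣>0 (fromWitness≡ refl))

      partner : ∃ λ b → R a₀ b ≡ true
      partner with ∣∣>0⇒∃ (≤-trans (≤-reflexive (sym (∣⁅a⁆∣≡1 a₀))) (hallS ⁅ a₀ ⁆ ⁅a₀⁆⊆S))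
      ... | b , b∈N with neighbours-elim b∈N
      ...   | a , a₀≡a , ab∈R = b , subst (λ x → R x b ≡ true) (sym (toWitness≡ a₀≡a)) ab∈R

      b₁ = proj₁ partner
      a₀b₁∈R = proj₂ partner
      R′ = R without ⁅ b₁ ⁆

      hallRest : HallCondition R′ (S ∖ ⁅ a₀ ⁆)
      hallRest Z Z⊆S∖a₀ with 0 <? ∣ Z ∣
      ... | no  ∣Z∣≯0 = ≤-trans (≮⇒≥ ∣Z∣≯0) z≤n
      ... | yes ∣Z∣>0 = +-cancelʳ-≤ 1 _ _ (begin
        ∣ Z ∣ + 1                         ≡⟨ +-comm ∣ Z ∣ 1 ⟩
        suc ∣ Z ∣                         ≤⟨ ≰⇒> (λ tight → noCritical Z (Z⊆S , ∣Z∣>0 , Z⊂S , tight)) ⟩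
        ∣ neighbours R Z ∣                ≤⟨ ∣∣-mono neighbours⊆without∪ ⟩
        ∣ neighbours R′ Z ∪ ⁅ b₁ ⁆ ∣      ≤⟨ ∣∪∣≤∣∣+∣∣ _ _ ⟩
        ∣ neighbours R′ Z ∣ + ∣ ⁅ b₁ ⁆ ∣  ≡⟨ cong (∣ neighbours R′ Z ∣ +_) (∣⁅a⁆∣≡1 b₁) ⟩
        ∣ neighbours R′ Z ∣ + 1           ∎)
        where
        open ≤-Reasoning
        Z⊆S : Z ⊆ S
        Z⊆S = proj₁ ∘ ∧-elim ∘ Z⊆S∖a₀
        Z⊂S : ∣ Z ∣ < ∣ S ∣
        Z⊂S = ≤-<-trans (∣∣-mono Z⊆S∖a₀) S∖a₀⊂S

  matchableUpTo : ∀ k → MatchableUpTo k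
  matchableUpTo k {S = S} ∣S∣≤k hallS with any? (λ a → S a Bool.≟ true)
  ... | no  S≡∅ = emptyMatching default λ a a∈S → S≡∅ (a , a∈S)
  matchableUpTo zero    ∣S∣≤0 _ | yes (a₀ , a₀∈S) = ⊥-elim (<⇒≱ (∈⇒∣∣>0 a₀∈S) ∣S∣≤0)
  matchableUpTo (suc k) {R} {S} ∣S∣≤1+k hallS | yes (a₀ , a₀∈S) with critical? R S
  ... | yes (v , critical) = viaCritical (matchableUpTo k) ∣S∣≤1+k hallS critical
  ... | no  ∄critical      = viaVertex (matchableUpTo k) ∣S∣≤1+k hallS a₀∈S λ X critical →
    ∄critical (tabulateᵛ X , Critical-cong (λ a → sym (lookup∘tabulate X a)) critical)

  hall : ∀ {R : BipRel m n} {S} → HallCondition R S → Matching R S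
  hall = matchableUpTo _ ≤-refl

-- Double counting in biregular graphs

opaque
  deg : BipRel m n → (Fin n → Bool) → Fin m → ℕ
  deg R Q a = ∣ (λ b → Q b ∧ R a b) ∣

  count≡deg : ∀ (R : BipRel m n) Q a → count (λ b → Q b ∧ R a b) ≡ deg R Q a
  count≡deg R Q a = count≡∣∣ _

  deg>0 : ∀ {R : BipRel m n} {Q a b} → Q b ≡ true → R a b ≡ true → 0 < deg R Q a
  deg>0 b∈Q ab∈R = ∈⇒∣∣>0 (cong₂ _∧_ b∈Q ab∈R)

  edges : BipRel m n → (Fin m → Bool) → (Fin n → Bool) → ℕ
  edges {m} R P Q = ∑[ a < m ] ∣ (λ b → P a ∧ (Q b ∧ R a b)) ∣

  edges-regular : ∀ {R : BipRel m n} {P Q d} → (∀ {a} → P a ≡ true → deg R Q a ≡ d) →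
                  edges R P Q ≡ ∣ P ∣ * d
  edges-regular {R = R} {P} {Q} regular =
    trans (sum-cong-≗ λ a → ∣∩∣≡𝟙*∣∣ (P a) (λ b → Q b ∧ R a b)) (∑𝟙*-const regular)

  edges-transpose : ∀ {R : BipRel m n} {P Q} → edges R P Q ≡ edges (flip R) Q P
  edges-transpose {R = R} {P} {Q} =
    trans (∑∣∣-comm λ a b → P a ∧ (Q b ∧ R a b))
          (sum-cong-≗ λ b → ∣∣-cong λ a → ∧-swap (P a) (Q b) (R a b))

  edges-mono : ∀ {R : BipRel m n} {P P′ Q Q′} →
               (∀ {a b} → P a ≡ true → Q b ≡ true → R a b ≡ true → P′ a ≡ true × Q′ b ≡ true) →
               edges R P Q ≤ edges R P′ Q′
  edges-mono {R = R} {P} {P′} {Q} {Q′} endpoints = ∑-mono-≤ λ a → ∣∣-mono (edge a)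
    where
    edge : ∀ a {b} → P a ∧ (Q b ∧ R a b) ≡ true → P′ a ∧ (Q′ b ∧ R a b) ≡ true
    edge a e =
      let (a∈P , e′)    = ∧-elim e
          (b∈Q , ab∈R)  = ∧-elim e′
          (a∈P′ , b∈Q′) = endpoints a∈P b∈Q ab∈R
      in cong₂ _∧_ a∈P′ (cong₂ _∧_ b∈Q′ ab∈R)

cross-≤ : ∀ x y p q {d e} .{{_ : NonZero d}} → x * d ≤ y * e → p * d ≡ q * e → x * q ≤ y * p
cross-≤ x y p q {d} {e} xd≤ye pd≡qe = *-cancelʳ-≤ (x * q) (y * p) d (begin
  x * q * d    ≡⟨ solve (x ∷ q ∷ d ∷ []) ⟩
  q * (x * d)  ≤⟨ *-monoʳ-≤ q xd≤ye ⟩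
  q * (y * e)  ≡⟨ solve (q ∷ y ∷ e ∷ []) ⟩
  y * (q * e)  ≡⟨ cong (y *_) pd≡qe ⟨
  y * (p * d)  ≡⟨ solve (y ∷ p ∷ d ∷ []) ⟩
  y * p * d    ∎)
  where open ≤-Reasoning

-- |P| d = |Q| e, and every edge leaving X ∩ P ends in N(X) ∩ Q.
biregular-expansion : ∀ (R : BipRel m n) {P Q d e} →
  (∀ {a} → P a ≡ true → deg R Q a ≡ d) → (∀ {b} → Q b ≡ true → deg (flip R) P b ≡ e) → 0 < d →
  ∀ X → ∣ X ∩ P ∣ * ∣ Q ∣ ≤ ∣ neighbours R X ∩ Q ∣ * ∣ P ∣
biregular-expansion R {P} {Q} {d} {e} P-regular Q-regular d>0 X =
  cross-≤ (∣ X ∩ P ∣) (∣ neighbours R X ∩ Q ∣) (∣ P ∣) (∣ Q ∣) {{>-nonZero d>0}} flow sizes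
  where
  open ≤-Reasoning
  sizes : ∣ P ∣ * d ≡ ∣ Q ∣ * e
  sizes = begin-equality
    ∣ P ∣ * d           ≡⟨ edges-regular P-regular ⟨
    edges R P Q         ≡⟨ edges-transpose ⟩
    edges (flip R) Q P  ≡⟨ edges-regular Q-regular ⟩
    ∣ Q ∣ * e           ∎
  flow : ∣ X ∩ P ∣ * d ≤ ∣ neighbours R X ∩ Q ∣ * e
  flow = begin
    ∣ X ∩ P ∣ * d                          ≡⟨ edges-regular (P-regular ∘ proj₂ ∘ ∧-elim) ⟨
    edges R (X ∩ P) Q                      ≤⟨ edges-mono (λ a∈X∩P b∈Q ab∈R →
                                                let (a∈X , a∈P) = ∧-elim a∈X∩P in
                                                a∈P , cong₂ _∧_ (neighbours-intro a∈X ab∈R) b∈Q) ⟩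
    edges R P (neighbours R X ∩ Q)         ≡⟨ edges-transpose ⟩
    edges (flip R) (neighbours R X ∩ Q) P  ≡⟨ edges-regular (Q-regular ∘ proj₂ ∘ ∧-elim) ⟩
    ∣ neighbours R X ∩ Q ∣ * e             ∎

-- Block densities

block : (Fin m → Fin k) → Fin m → Fin m → Bool
block p a = inBlock p (p a)

block-sym : ∀ (p : Fin m → Fin k) a a′ → block p a a′ ≡ block p a′ a
block-sym p a a′ with p a′ ≟ p a | p a ≟ p a′
... | yes _      | yes _      = refl
... | no  _      | no  _      = refl
... | yes pa′≡pa | no  pa≢pa′ = ⊥-elim (pa≢pa′ (sym pa′≡pa))
... | no  pa′≢pa | yes pa≡pa′ = ⊥-elim (pa′≢pa (sym pa≡pa′))

∣block∣>0 : ∀ (p : Fin m → Fin k) a → 0 < ∣ block p a ∣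
∣block∣>0 p a = ∈⇒∣∣>0 (fromWitness≡ refl)

0<m≤n⇒m∣n! : ∀ {m n} → 0 < m → m ≤ n → m ∣ n !
0<m≤n⇒m∣n! {suc m} _ m≤n = ∣-trans (m∣m*n (m !)) (m≤n⇒m!∣n! m≤n)

-- u a = N! / |block p a|: a common denominator for the densities of all blocks.
blockWeight : ∀ (p : Fin m → Fin k) {N} → m ≤ N →
              ∃ λ (u : Fin m → ℕ) → ∀ a → u a * ∣ block p a ∣ ≡ N !
blockWeight p {N} m≤N = (λ a → quotient (∣block∣∣N! a)) , (λ a → sym (_∣_.equality (∣block∣∣N! a)))
  where
  ∣block∣∣N! : ∀ a → ∣ block p a ∣ ∣ N !
  ∣block∣∣N! a = 0<m≤n⇒m∣n! (∣block∣>0 p a) (≤-trans (∣∣≤n (block p a)) m≤N)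

∑-blockDensity : ∀ (p : Fin m → Fin k) {u : Fin m → ℕ} {C} → (∀ a → u a * ∣ block p a ∣ ≡ C) →
                 ∀ X → ∑[ a < m ] (∣ X ∩ block p a ∣ * u a) ≡ ∣ X ∣ * C
∑-blockDensity {m} p {u} {C} weight X = begin
  ∑[ a < m ] (∣ X ∩ block p a ∣ * u a)
    ≡⟨ sum-cong-≗ (λ a → ∑𝟙*≡∣∣* (X ∩ block p a) (u a)) ⟨
  ∑[ a < m ] ∑[ a′ < m ] (𝟙 (X a′ ∧ block p a a′) * u a)
    ≡⟨ ∑-comm (λ a a′ → 𝟙 (X a′ ∧ block p a a′) * u a) ⟩
  ∑[ a′ < m ] ∑[ a < m ] (𝟙 (X a′ ∧ block p a a′) * u a)
    ≡⟨ sum-cong-≗ (λ a′ → sum-cong-≗ (regroup a′)) ⟩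
  ∑[ a′ < m ] ∑[ a < m ] (𝟙 (X a′) * (𝟙 (block p a′ a) * u a))
    ≡⟨ sum-cong-≗ (λ a′ → *-distribˡ-sum (𝟙 (X a′)) (λ a → 𝟙 (block p a′ a) * u a)) ⟨
  ∑[ a′ < m ] (𝟙 (X a′) * ∑[ a < m ] (𝟙 (block p a′ a) * u a))
    ≡⟨ sum-cong-≗ (λ a′ → cong (𝟙 (X a′) *_) (blockTotal a′)) ⟩
  ∑[ a′ < m ] (𝟙 (X a′) * C)
    ≡⟨ ∑𝟙*≡∣∣* X C ⟩
  ∣ X ∣ * C
    ∎
  where
  open ≡-Reasoning
  regroup : ∀ a′ a → 𝟙 (X a′ ∧ block p a a′) * u a ≡ 𝟙 (X a′) * (𝟙 (block p a′ a) * u a)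
  regroup a′ a = begin
    𝟙 (X a′ ∧ block p a a′) * u a        ≡⟨ cong (_* u a) (𝟙-∧ (X a′) (block p a a′)) ⟩
    𝟙 (X a′) * 𝟙 (block p a a′) * u a    ≡⟨ *-assoc (𝟙 (X a′)) _ (u a) ⟩
    𝟙 (X a′) * (𝟙 (block p a a′) * u a)  ≡⟨ cong (λ β → 𝟙 (X a′) * (𝟙 β * u a)) (block-sym p a a′) ⟩
    𝟙 (X a′) * (𝟙 (block p a′ a) * u a)  ∎
  sameBlock⇒sameWeight : ∀ a′ {a} → block p a′ a ≡ true → u a ≡ u a′
  sameBlock⇒sameWeight a′ {a} a∈block = *-cancelʳ-≡ (u a) (u a′) _ {{>-nonZero (∣block∣>0 p a)}}
    (trans (weight a) (trans (sym (weight a′))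
                             (cong (λ i → u a′ * ∣ inBlock p i ∣) (sym (toWitness≡ a∈block)))))
  blockTotal : ∀ a′ → ∑[ a < m ] (𝟙 (block p a′ a) * u a) ≡ C
  blockTotal a′ = trans (∑𝟙*-const (sameBlock⇒sameWeight a′)) (trans (*-comm _ (u a′)) (weight a′))

≤-byBlockDensity : ∀ (p : Fin m → Fin k) (q : Fin n → Fin l) {M : Fin m → Fin n} →
  Injective _≡_ _≡_ M → ∀ X Y →
  (∀ a → ∣ X ∩ block p a ∣ * ∣ block q (M a) ∣ ≤ ∣ Y ∩ block q (M a) ∣ * ∣ block p a ∣) →
  ∣ X ∣ ≤ ∣ Y ∣
≤-byBlockDensity {m} {n = n} p q {M} M-injective X Y denser = *-cancelʳ-≤ _ _ C (begin
  ∣ X ∣ * C                                     ≡⟨ ∑-blockDensity p u-weight X ⟨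
  ∑[ a < m ] (∣ X ∩ block p a ∣ * u a)          ≤⟨ ∑-mono-≤ rescaled ⟩
  ∑[ a < m ] (∣ Y ∩ block q (M a) ∣ * v (M a))  ≤⟨ ∑-injective-≤ M-injective (λ b → density b) ⟩
  ∑[ b < n ] density b                          ≡⟨ ∑-blockDensity q v-weight Y ⟩
  ∣ Y ∣ * C                                     ∎)
  where
  open ≤-Reasoning
  C = (m + n) !
  instance
    C≢0 : NonZero C
    C≢0 = (m + n) !≢0
  u = proj₁ (blockWeight p (m≤m+n m n))
  u-weight = proj₂ (blockWeight p (m≤m+n m n))
  v = proj₁ (blockWeight q (m≤n+m n m))
  v-weight = proj₂ (blockWeight q (m≤n+m n m))
  density : Fin n → ℕ
  density b = ∣ Y ∩ block q b ∣ * v b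
  rescaled : ∀ a → ∣ X ∩ block p a ∣ * u a ≤ ∣ Y ∩ block q (M a) ∣ * v (M a)
  rescaled a = cross-≤ (∣ X ∩ block p a ∣) (∣ Y ∩ block q (M a) ∣) (v (M a)) (u a)
                 {{>-nonZero (∣block∣>0 q (M a))}} (denser a)
                 (trans (v-weight (M a)) (sym (u-weight a)))

record Equitable (R : BipRel m n) (p : Fin m → Fin k) (q : Fin n → Fin l) : Set where
  field
    rows-regular    : ∀ {a a′} → p a ≡ p a′ → ∀ j →
                      deg R (inBlock q j) a ≡ deg R (inBlock q j) a′
    columns-regular : ∀ {b b′} → q b ≡ q b′ → ∀ i →
                      deg (flip R) (inBlock p i) b ≡ deg (flip R) (inBlock p i) b′

linked-expansion : ∀ {R : BipRel m n} {p : Fin m → Fin k} {q : Fin n → Fin l} → Equitable R p q →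
  ∀ {a b} → RPlus R p q a b →
  ∀ X → ∣ X ∩ block p a ∣ * ∣ block q b ∣ ≤ ∣ neighbours R X ∩ block q b ∣ * ∣ block p a ∣
linked-expansion {R = R} {p} {q} equitable {a} {b} (a′ , b′ , pa′≡pa , qb′≡qb , a′b′∈R) =
  biregular-expansion R rows columns (deg>0 (fromWitness≡ qb′≡qb) a′b′∈R)
  where
  open Equitable equitable
  rows : ∀ {x} → block p a x ≡ true → deg R (block q b) x ≡ deg R (block q b) a′
  rows x∈A = rows-regular (trans (toWitness≡ x∈A) (sym pa′≡pa)) (q b)
  columns : ∀ {y} → block q b y ≡ true → deg (flip R) (block p a) y ≡ deg (flip R) (block p a) b′
  columns y∈B = columns-regular (trans (toWitness≡ y∈B) (sym qb′≡qb)) (p a)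

mainTheorem2 : (m n k l : ℕ) (R : BipRel m n)
               (p : Fin m → Fin k) (q : Fin n → Fin l) →
               (∀ i j a a' → p a ≡ i → p a' ≡ i →
                  degInto R q a j ≡ degInto R q a' j) →
               (∀ i j b b' → q b ≡ j → q b' ≡ j →
                  degFrom R p b i ≡ degFrom R p b' i) →
               CompleteMatching (RPlus R p q) →
               CompleteMatching (λ a b → R a b ≡ true)
mainTheorem2 m n k l R p q H1 H2 (M⁺ , M⁺-injective , M⁺⊆R⁺) =
  match , match-injective refl refl , λ a → match-edge refl
  where
  equitable : Equitable R p q
  equitable = record
    { rows-regular    = λ {a} {a′} pa≡pa′ j →
        trans (sym (count≡deg R (inBlock q j) a))
              (trans (H1 _ j a a′ pa≡pa′ refl) (count≡deg R (inBlock q j) a′))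
    ; columns-regular = λ {b} {b′} qb≡qb′ i →
        trans (sym (count≡deg (flip R) (inBlock p i) b))
              (trans (H2 i _ b b′ qb≡qb′ refl) (count≡deg (flip R) (inBlock p i) b′))
    }

  hallCondition : HallCondition R (λ _ → true)
  hallCondition X _ = ≤-byBlockDensity p q M⁺-injective X (neighbours R X) λ a →
    linked-expansion equitable (M⁺⊆R⁺ a) X

  open Matching (hall M⁺ hallCondition)
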